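{- Let $M$ be a binary matroid on a finite set $E$, $X\subseteq E$ with $e\in X$, and $M^e_X$ the es-splitting matroid. Let $A'\subseteq E\cup\{a,\gamma\}$ and $A=A'\setminus\{a,\gamma\}$. Suppose $e\notin cl(A)$ and one of the following holds: (1) $A'=A$ and $A$ contains an OX-circuit of $M$; (2) $A'=A\cup\{a\}$. Then $cl'(A')=cl(A)\cup\{a\}$.
   Context: Let $a,\gamma\notin E$ be two new elements. Let $A_M$ be a matrix over GF(2) representing $M$ (columns indexed by $E$). Form $A^e_X$ from $A_M$ by appending a new row $\delta_X$ whose entries are $1$ in the columns of elements of $X$ and $0$ elsewhere, and then appending two new columns: a column $a$ which is $0$ everywhere except for a $1$ in the new last row, and a column $\gamma$ which is the GF(2)-sum of the columns $a$ and $e$. The es-splitting matroid $M^e_X$ is the vector matroid of $A^e_X$, with ground set $E\cup\{a,\gamma\}$. $cl$ and $cl'$ denote the closure operators of $M$ and $M^e_X$. An OX-circuit of $M$ is a circuit of $M$ containing an odd number of elements of $X$; a set "contains an OX-circuit" if some OX-circuit of $M$ is a subset of it. -}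

module Defs where

open import Data.Nat using (ℕ; zero; suc; _+_; _≤_; _%_)
open import Data.Bool using (Bool; true; false; _∧_; _xor_)
open import Data.Fin using (Fin; zero; suc; _↑ˡ_; _↑ʳ_; splitAt)
open import Data.Fin.Subset using (Subset; _∈_; _∉_; _⊆_; _⊂_; _∩_; _∪_; ⁅_⁆; ∣_∣; Nonempty)
open import Data.Vec using (lookup; tabulate)
open import Data.Sum using (_⊎_; inj₁; inj₂)
open import Data.Product using (Σ; ∃; _×_; _,_)
open import Relation.Nullary using (¬_)
open import Relation.Binary.PropositionalEquality using (_≡_)

-- Matrices over GF(2) (Bool with xor as addition, ∧ as multiplication)
-- A matrix with m rows and n columns; columns index the ground set Fin n.

Mat : ℕ → ℕ → Set
Mat m n = Fin m → Fin n → Bool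

sumF : ∀ {n} → (Fin n → Bool) → Bool
sumF {zero}  f = false
sumF {suc n} f = f zero xor sumF (λ j → f (suc j))

colSum : ∀ {m n} → Mat m n → Subset n → Fin m → Bool
colSum A S i = sumF (λ j → lookup S j ∧ A i j)

-- The vector matroid M[A] of a GF(2)-matrix A, ground set Fin n.
-- Over GF(2), a set of columns is linearly dependent iff some nonempty
-- subset of it sums to the zero vector.

Dependent : ∀ {m n} → Mat m n → Subset n → Set
Dependent A D = Σ _ λ S → S ⊆ D × Nonempty S × (∀ i → colSum A S i ≡ false)

Independent : ∀ {m n} → Mat m n → Subset n → Set
Independent A I = ¬ Dependent A I

Circuit : ∀ {m n} → Mat m n → Subset n → Set
Circuit A C = Dependent A C × (∀ D → D ⊂ C → Independent A D)

IsRank : ∀ {m n} → Mat m n → Subset n → ℕ → Set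
IsRank A S k =
  (Σ _ λ I → I ⊆ S × Independent A I × ∣ I ∣ ≡ k) ×
  (∀ I → I ⊆ S → Independent A I → ∣ I ∣ ≤ k)

InCl : ∀ {m n} → Mat m n → Subset n → Fin n → Set
InCl A S x = ∃ λ k → IsRank A S k × IsRank A (S ∪ ⁅ x ⁆) k

OXCircuit : ∀ {m n} → Mat m n → Subset n → Subset n → Set
OXCircuit A X C = Circuit A C × ∣ C ∩ X ∣ % 2 ≡ 1

ContainsOXCircuit : ∀ {m n} → Mat m n → Subset n → Subset n → Set
ContainsOXCircuit A X S = Σ _ λ C → OXCircuit A X C × C ⊆ S

-- Rows: Fin (m + 1); old row i is (i ↑ˡ 1), the new row δ_X is (m ↑ʳ zero).
-- Columns: Fin (n + 2); element j ∈ E is (j ↑ˡ 2),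
-- a is (n ↑ʳ zero), γ is (n ↑ʳ suc zero).

embE : ∀ {n} → Fin n → Fin (n + 2)
embE j = j ↑ˡ 2

aCol : ∀ {n} → Fin (n + 2)
aCol {n} = n ↑ʳ zero

γCol : ∀ {n} → Fin (n + 2)
γCol {n} = n ↑ʳ suc zero

withRow : ∀ {m n} → Mat m n → Subset n → Mat (m + 1) n
withRow {m} A X r j with splitAt m r
... | inj₁ i = A i j
... | inj₂ _ = lookup X j

colA : ∀ {m} → Fin (m + 1) → Bool
colA {m} r with splitAt m r
... | inj₁ _ = false
... | inj₂ _ = true

esMatrix : ∀ {m n} → Mat m n → Subset n → Fin n → Mat (m + 1) (n + 2)
esMatrix {m} {n} A X e r c with splitAt n c
... | inj₁ j = withRow A X r j
... | inj₂ zero = colA r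
... | inj₂ (suc zero) = colA r xor withRow A X r e

restrictE : ∀ {n} → Subset (n + 2) → Subset n
restrictE A′ = tabulate (λ j → lookup A′ (embE j))

-- Over GF(2), x ∈ cl(S) exactly when the column of x is a sum of columns of S, so the
-- theorem is a statement about the span of the columns of A′ in A^e_X. That span contains
-- the column of a: in case (2) because a ∈ A′, in case (1) because an OX-circuit sums to
-- zero in A_M and to 1 in the row δ_X. Since γ ∉ A′, a vector then lies in the span
-- exactly when its restriction to the rows of A_M lies in the span of the columns of A.
-- Reading this off for the columns of y ∈ E, of a and of γ gives the theorem; γ is
-- excluded because its restriction is the column of e and e ∉ cl(A).
module Submission where

open import Defs
open import Algebra.Bundles using (CommutativeRing)
open import Data.Bool using (Bool; true; false; not; _∧_; _xor_)
open import Data.Bool.Properties as Bool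
  using (xor-assoc; xor-comm; xor-identityʳ; xor-same; true-xor; ∧-distribʳ-xor; ¬-not
        ; not-involutive; xor-∧-commutativeRing)
open import Data.Empty using (⊥-elim)
open import Data.Fin using (Fin; zero; suc; _↑ˡ_; _↑ʳ_; splitAt; _≟_)
open import Data.Fin.Properties using (splitAt-↑ˡ; splitAt-↑ʳ; splitAt⁻¹-↑ˡ; splitAt⁻¹-↑ʳ; all?)
open import Data.Fin.Subset
  using (Subset; _∈_; _∉_; _⊆_; _⊂_; _∩_; _∪_; _─_; _-_; ⁅_⁆; ∣_∣; Nonempty)
  renaming (⊥ to ∅)
open import Data.Fin.Subset.Properties
open import Data.Nat using (ℕ; zero; suc; _+_; _≤_; _<_; _%_; z≤n; s≤s)
open import Data.Nat.Induction using (<-wellFounded)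
open import Data.Nat.Properties
  using (≤-trans; ≤-reflexive; n≤1+n; +-suc; +-comm; <-irrefl; module ≤-Reasoning)
open import Data.Product using (Σ; _×_; _,_; proj₁; proj₂)
open import Data.Sum using (_⊎_; inj₁; inj₂; [_,_]′)
open import Data.Vec using (_∷_; []; here; there; lookup; zipWith)
open import Data.Vec.Properties using ([]=⇒lookup; lookup⇒[]=; lookup-zipWith; lookup∘tabulate)
open import Function using (_∘_)
open import Function.Bundles using (_⇔_; mk⇔; Equivalence)
open import Function.Construct.Composition using (_⇔-∘_)
open import Induction.WellFounded using (Acc; acc)
open import Relation.Nullary using (¬_; Dec; yes; no)
open import Relation.Nullary.Decidable using (_×-dec_)
open import Relation.Binary.PropositionalEquality
  using (_≡_; _≢_; _≗_; refl; sym; trans; cong; cong₂; subst)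
open import Algebra.Properties.CommutativeSemigroup
  (CommutativeRing.+-commutativeSemigroup xor-∧-commutativeRing) using (interchange)

private
  variable
    m n n′ : ℕ

xor-cancelˡ : ∀ a b → a xor (a xor b) ≡ b
xor-cancelˡ a b = trans (sym (xor-assoc a a b)) (cong (_xor b) (xor-same a))

infixr 6 _△_

_△_ : Subset n → Subset n → Subset n
p △ q = zipWith _xor_ p q

x∈p△q⁻ : ∀ {x : Fin n} (p q : Subset n) → x ∈ p △ q → (x ∈ p × x ∉ q) ⊎ (x ∉ p × x ∈ q)
x∈p△q⁻ (true ∷ p) (false ∷ q) here = inj₁ (here , λ ())
x∈p△q⁻ (false ∷ p) (true ∷ q) here = inj₂ ((λ ()) , here)
x∈p△q⁻ (s ∷ p) (t ∷ q) (there x∈) with x∈p△q⁻ p q x∈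
... | inj₁ (x∈p , x∉q) = inj₁ (there x∈p , λ x∈ → x∉q (drop-there x∈))
... | inj₂ (x∉p , x∈q) = inj₂ ((λ x∈ → x∉p (drop-there x∈)) , there x∈q)

x∈p△⁅y⁆⁻ : ∀ {x y : Fin n} {p : Subset n} → x ∈ p △ ⁅ y ⁆ → (x ∈ p × x ≢ y) ⊎ (x ≡ y × x ∉ p)
x∈p△⁅y⁆⁻ {y = y} {p} x∈ with x∈p△q⁻ p ⁅ y ⁆ x∈
... | inj₁ (x∈p , x∉⁅y⁆) = inj₁ (x∈p , x∉⁅y⁆⇒x≢y x∉⁅y⁆)
... | inj₂ (x∉p , x∈⁅y⁆) = inj₂ (x∈⁅y⁆⇒x≡y y x∈⁅y⁆ , x∉p)

x∉p∧x∈q⇒x∈p△q : ∀ {x : Fin n} {p q : Subset n} → x ∉ p → x ∈ q → x ∈ p △ q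
x∉p∧x∈q⇒x∈p△q {p = false ∷ p} x∉p here = here
x∉p∧x∈q⇒x∈p△q {p = true ∷ p} x∉p here = ⊥-elim (x∉p here)
x∉p∧x∈q⇒x∈p△q {p = _ ∷ p} x∉p (there x∈q) = there (x∉p∧x∈q⇒x∈p△q (λ x∈ → x∉p (there x∈)) x∈q)

x∈p─q⇒x∉q : ∀ {x : Fin n} (p q : Subset n) → x ∈ p ─ q → x ∉ q
x∈p─q⇒x∉q {x = zero} (true ∷ p) (false ∷ q) here = λ ()
x∈p─q⇒x∉q {x = zero} (false ∷ p) (false ∷ q) ()
x∈p─q⇒x∉q {x = zero} (_ ∷ p) (true ∷ q) ()
x∈p─q⇒x∉q {x = suc x} (_ ∷ p) (_ ∷ q) (there x∈) x∈q = x∈p─q⇒x∉q p q x∈ (drop-there x∈q)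

Empty[p─q]⇒p⊆q : (p q : Subset n) → ¬ Nonempty (p ─ q) → p ⊆ q
Empty[p─q]⇒p⊆q p q empty {x} x∈p with x ∈? q
... | yes x∈q = x∈q
... | no x∉q = ⊥-elim (empty (x , x∈p∧x∉q⇒x∈p─q x∈p x∉q))

∣p∪q∣≤∣p∣+∣q∣ : (p q : Subset n) → ∣ p ∪ q ∣ ≤ ∣ p ∣ + ∣ q ∣
∣p∪q∣≤∣p∣+∣q∣ [] [] = z≤n
∣p∪q∣≤∣p∣+∣q∣ (true ∷ p) (true ∷ q) =
  s≤s (≤-trans (∣p∪q∣≤∣p∣+∣q∣ p q) (≤-trans (n≤1+n _) (≤-reflexive (sym (+-suc _ _)))))
∣p∪q∣≤∣p∣+∣q∣ (true ∷ p) (false ∷ q) = s≤s (∣p∪q∣≤∣p∣+∣q∣ p q)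
∣p∪q∣≤∣p∣+∣q∣ (false ∷ p) (true ∷ q) =
  ≤-trans (s≤s (∣p∪q∣≤∣p∣+∣q∣ p q)) (≤-reflexive (sym (+-suc _ _)))
∣p∪q∣≤∣p∣+∣q∣ (false ∷ p) (false ∷ q) = ∣p∪q∣≤∣p∣+∣q∣ p q

col : Mat m n → Fin n → Fin m → Bool
col A x i = A i x

sumF-cong : (f g : Fin n → Bool) → f ≗ g → sumF f ≡ sumF g
sumF-cong {zero} f g f≗g = refl
sumF-cong {suc n} f g f≗g =
  cong₂ _xor_ (f≗g zero) (sumF-cong (λ j → f (suc j)) (λ j → g (suc j)) (λ j → f≗g (suc j)))

sumF-xor : (f g : Fin n → Bool) → sumF (λ j → f j xor g j) ≡ sumF f xor sumF g
sumF-xor {zero} f g = refl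
sumF-xor {suc n} f g =
  trans (cong ((f zero xor g zero) xor_) (sumF-xor (λ j → f (suc j)) (λ j → g (suc j))))
        (interchange (f zero) (g zero) _ _)

colSum-△ : (A : Mat m n) (S T : Subset n) → ∀ i → colSum A (S △ T) i ≡ colSum A S i xor colSum A T i
colSum-△ A S T i =
  trans (sumF-cong _ _ (λ j → trans (cong (_∧ A i j) (lookup-zipWith _xor_ j S T))
                                    (∧-distribʳ-xor (A i j) (lookup S j) (lookup T j))))
        (sumF-xor (λ j → lookup S j ∧ A i j) (λ j → lookup T j ∧ A i j))

colSum-∅ : (A : Mat m n) → ∀ i → colSum A ∅ i ≡ false
colSum-∅ {n = zero} A i = refl
colSum-∅ {n = suc n} A i = colSum-∅ (λ i j → A i (suc j)) i

colSum-⁅⁆ : (A : Mat m n) (x : Fin n) → ∀ i → colSum A ⁅ x ⁆ i ≡ A i x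
colSum-⁅⁆ A zero i =
  trans (cong (A i zero xor_) (colSum-∅ (λ i j → A i (suc j)) i)) (xor-identityʳ _)
colSum-⁅⁆ A (suc x) i = colSum-⁅⁆ (λ i j → A i (suc j)) x i

colSum-△⁅⁆ : (A : Mat m n) (S : Subset n) {u : Fin m → Bool} (x : Fin n) →
  colSum A S ≗ u → colSum A (S △ ⁅ x ⁆) ≗ (λ i → u i xor A i x)
colSum-△⁅⁆ A S x sum i = trans (colSum-△ A S ⁅ x ⁆ i) (cong₂ _xor_ (sum i) (colSum-⁅⁆ A x i))

colSum-ind : (P : (Fin m → Bool) → Set) → P (λ _ → false) →
  (∀ {u v} → P u → P v → P (λ i → u i xor v i)) →
  (A : Mat m n) (T : Subset n) → (∀ {j} → j ∈ T → P (col A j)) → P (colSum A T)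
colSum-ind P p0 p+ A [] h = p0
colSum-ind P p0 p+ A (true ∷ T) h =
  p+ (h here) (colSum-ind P p0 p+ (λ i j → A i (suc j)) T (λ j∈ → h (there j∈)))
colSum-ind P p0 p+ A (false ∷ T) h =
  colSum-ind P p0 p+ (λ i j → A i (suc j)) T (λ j∈ → h (there j∈))

Span : Mat m n → Subset n → (Fin m → Bool) → Set
Span A K v = Σ (Subset _) λ T → T ⊆ K × colSum A T ≗ v

span? : (A : Mat m n) (K : Subset n) (v : Fin m → Bool) → Dec (Span A K v)
span? A K v = anySubset? (λ T → (T ⊆? K) ×-dec all? (λ i → colSum A T i Bool.≟ v i))

module _ {A : Mat m n} where

  span-cong : ∀ {K u v} → u ≗ v → Span A K u → Span A K v
  span-cong u≗v (T , T⊆K , sum) = T , T⊆K , λ i → trans (sum i) (u≗v i)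

  span-mono : ∀ {K K′ v} → K ⊆ K′ → Span A K v → Span A K′ v
  span-mono K⊆K′ (T , T⊆K , sum) = T , (λ x∈ → K⊆K′ (T⊆K x∈)) , sum

  span-col : ∀ {K x} → x ∈ K → Span A K (col A x)
  span-col {x = x} x∈K =
    ⁅ x ⁆ , (λ y∈ → subst (_∈ _) (sym (x∈⁅y⁆⇒x≡y x y∈)) x∈K) , colSum-⁅⁆ A x

  span-zero : ∀ {K} → Span A K (λ _ → false)
  span-zero = ∅ , (λ x∈ → ⊥-elim (∉⊥ x∈)) , colSum-∅ A

  span-xor : ∀ {K u v} → Span A K u → Span A K v → Span A K (λ i → u i xor v i)
  span-xor (T , T⊆K , sumT) (U , U⊆K , sumU) =
    T △ U , T△U⊆K , λ i → trans (colSum-△ A T U i) (cong₂ _xor_ (sumT i) (sumU i))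
    where
    T△U⊆K : T △ U ⊆ _
    T△U⊆K x∈ with x∈p△q⁻ T U x∈
    ... | inj₁ (x∈T , _) = T⊆K x∈T
    ... | inj₂ (_ , x∈U) = U⊆K x∈U

  span-rows : ∀ {m′} (f : Fin m′ → Fin m) {K v} →
    Span A K v → Span (λ i → A (f i)) K (λ i → v (f i))
  span-rows f (T , T⊆K , sum) = T , T⊆K , λ i → sum (f i)

span-trans : ∀ {A : Mat m n} {B : Mat m n′} {J K v} →
  (∀ {j} → j ∈ J → Span B K (col A j)) → Span A J v → Span B K v
span-trans {A = A} {B} {K = K} J⊆spanK (T , T⊆J , sum) =
  span-cong sum (colSum-ind (Span B K) span-zero span-xor A T (λ j∈ → J⊆spanK (T⊆J j∈)))

-- Independence and the exchange lemma

spanned⇒dependent : ∀ {A : Mat m n} {I K x} → x ∈ I → x ∉ K → K ⊆ I →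
  Span A K (col A x) → Dependent A I
spanned⇒dependent {A = A} {I} {x = x} x∈I x∉K K⊆I (T , T⊆K , sum) =
  T △ ⁅ x ⁆ , T△x⊆I , (x , x∉p∧x∈q⇒x∈p△q (λ x∈T → x∉K (T⊆K x∈T)) (x∈⁅x⁆ x)) ,
  λ i → trans (colSum-△⁅⁆ A T x sum i) (xor-same (A i x))
  where
  T△x⊆I : T △ ⁅ x ⁆ ⊆ I
  T△x⊆I z∈ with x∈p△⁅y⁆⁻ {p = T} z∈
  ... | inj₁ (z∈T , _) = K⊆I (T⊆K z∈T)
  ... | inj₂ (refl , _) = x∈I

independent-∪⁅⁆ : ∀ {A : Mat m n} {I x} → Independent A I → ¬ Span A I (col A x) →
  Independent A (I ∪ ⁅ x ⁆)
independent-∪⁅⁆ {A = A} {I} {x} indI x∉spanI (S , S⊆I∪x , nonempty , sum) with x ∈? S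
... | yes x∈S = x∉spanI (S △ ⁅ x ⁆ , S△x⊆I , colSum-△⁅⁆ A S x sum)
  where
  S△x⊆I : S △ ⁅ x ⁆ ⊆ I
  S△x⊆I z∈ with x∈p△⁅y⁆⁻ {p = S} z∈
  ... | inj₂ (refl , x∉S) = ⊥-elim (x∉S x∈S)
  ... | inj₁ (z∈S , z≢x) with x∈p∪q⁻ I ⁅ x ⁆ (S⊆I∪x z∈S)
  ...   | inj₁ z∈I = z∈I
  ...   | inj₂ z∈⁅x⁆ = ⊥-elim (z≢x (x∈⁅y⁆⇒x≡y x z∈⁅x⁆))
... | no x∉S = indI (S , S⊆I , nonempty , sum)
  where
  S⊆I : S ⊆ I
  S⊆I z∈S with x∈p∪q⁻ I ⁅ x ⁆ (S⊆I∪x z∈S)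
  ... | inj₁ z∈I = z∈I
  ... | inj₂ z∈⁅x⁆ = ⊥-elim (x∉S (subst (_∈ S) (x∈⁅y⁆⇒x≡y x z∈⁅x⁆) z∈S))

exchange : ∀ {A : Mat m n} {J T i j} → T ⊆ J → colSum A T ≗ col A i → j ∈ T →
  ∀ {z} → z ∈ J → Span A ((J - j) ∪ ⁅ i ⁆) (col A z)
exchange {A = A} {J} {T} {i} {j} T⊆J sum j∈T {z} z∈J with z ≟ j
... | no z≢j = span-col (x∈p∪q⁺ (inj₁ (x∈p∧x≢y⇒x∈p-y z∈J z≢j)))
... | yes refl = span-cong (λ r → xor-cancelˡ (A r i) (A r j))
                   (span-xor (span-col (x∈p∪q⁺ (inj₂ (x∈⁅x⁆ i))))
                             (T △ ⁅ j ⁆ , T△j⊆J′ , colSum-△⁅⁆ A T j sum))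
  where
  T△j⊆J′ : T △ ⁅ j ⁆ ⊆ (J - j) ∪ ⁅ i ⁆
  T△j⊆J′ y∈ with x∈p△⁅y⁆⁻ {p = T} y∈
  ... | inj₁ (y∈T , y≢j) = x∈p∪q⁺ (inj₁ (x∈p∧x≢y⇒x∈p-y (T⊆J y∈T) y≢j))
  ... | inj₂ (refl , j∉T) = ⊥-elim (j∉T j∈T)

exchange-size : ∀ {J : Subset n} {j} i → j ∈ J → ∣ (J - j) ∪ ⁅ i ⁆ ∣ ≤ ∣ J ∣
exchange-size {J = J} {j} i j∈J = begin
  ∣ (J - j) ∪ ⁅ i ⁆ ∣   ≤⟨ ∣p∪q∣≤∣p∣+∣q∣ (J - j) ⁅ i ⁆ ⟩
  ∣ J - j ∣ + ∣ ⁅ i ⁆ ∣ ≡⟨ cong (∣ J - j ∣ +_) (∣⁅x⁆∣≡1 i) ⟩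
  ∣ J - j ∣ + 1         ≡⟨ +-comm _ 1 ⟩
  suc ∣ J - j ∣         ≤⟨ x∈p⇒∣p-x∣<∣p∣ j∈J ⟩
  ∣ J ∣                 ∎
  where open ≤-Reasoning

exchange-decreases : ∀ {I J : Subset n} {i j} → i ∈ I ─ J → j ∉ I →
  ∣ I ─ ((J - j) ∪ ⁅ i ⁆) ∣ < ∣ I ─ J ∣
exchange-decreases {I = I} {J} {i} {j} i∈I─J j∉I = p⊂q⇒∣p∣<∣q∣ (shrinks , i , i∈I─J , i∉)
  where
  shrinks : I ─ ((J - j) ∪ ⁅ i ⁆) ⊆ I ─ J
  shrinks {z} z∈ = x∈p∧x∉q⇒x∈p─q z∈I z∉J
    where
    z∈I = p─q⊆p I _ z∈
    z∉J : z ∉ J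
    z∉J z∈J = x∈p─q⇒x∉q I _ z∈
      (x∈p∪q⁺ (inj₁ (x∈p∧x≢y⇒x∈p-y z∈J (λ { refl → j∉I z∈I }))))
  i∉ : i ∉ I ─ ((J - j) ∪ ⁅ i ⁆)
  i∉ i∈ = x∈p─q⇒x∉q I _ i∈ (x∈p∪q⁺ (inj₂ (x∈⁅x⁆ i)))

module _ {A : Mat m n} {I : Subset n} (indI : Independent A I) where

  steinitz-acc : ∀ J → Acc _<_ ∣ I ─ J ∣ → (∀ {i} → i ∈ I → Span A J (col A i)) → ∣ I ∣ ≤ ∣ J ∣
  steinitz-acc J (acc rec) I⊆spanJ with nonempty? (I ─ J)
  ... | no empty = p⊆q⇒∣p∣≤∣q∣ (Empty[p─q]⇒p⊆q I J empty)
  ... | yes (i , i∈I─J) with I⊆spanJ (p─q⊆p I J i∈I─J)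
  ...   | T , T⊆J , sum with nonempty? (T ─ I)
  -- T ⊆ I would express the column of i ∈ I through other columns of I.
  ...     | no empty = ⊥-elim (indI (spanned⇒dependent (p─q⊆p I J i∈I─J)
                                       (λ i∈T → x∈p─q⇒x∉q I J i∈I─J (T⊆J i∈T))
                                       (Empty[p─q]⇒p⊆q T I empty) (T , (λ x∈ → x∈) , sum)))
  ...     | yes (j , j∈T─I) =
    ≤-trans (steinitz-acc ((J - j) ∪ ⁅ i ⁆) (rec (exchange-decreases i∈I─J j∉I))
               (λ i′∈I → span-trans (exchange T⊆J sum j∈T) (I⊆spanJ i′∈I)))
            (exchange-size i (T⊆J j∈T))
    where
    j∈T = p─q⊆p T I j∈T─I
    j∉I = x∈p─q⇒x∉q T I j∈T─I

  steinitz : ∀ {J} → (∀ {i} → i ∈ I → Span A J (col A i)) → ∣ I ∣ ≤ ∣ J ∣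
  steinitz {J} = steinitz-acc J (<-wellFounded _)

-- Bases, rank and closure

Basis : Mat m n → Subset n → Subset n → Set
Basis A S J = J ⊆ S × Independent A J × (∀ {s} → s ∈ S → Span A J (col A s))

module _ {A : Mat m n} where

  Basis⇒IsRank : ∀ {S J} → Basis A S J → IsRank A S ∣ J ∣
  Basis⇒IsRank {J = J} (J⊆S , indJ , S⊆spanJ) =
    (J , J⊆S , indJ , refl) , λ I I⊆S indI → steinitz indI (λ i∈I → S⊆spanJ (I⊆S i∈I))

  basis-∪⁅⁆ : ∀ {S J x} → Basis A S J → Span A S (col A x) → Basis A (S ∪ ⁅ x ⁆) J
  basis-∪⁅⁆ {S} {J} {x} (J⊆S , indJ , S⊆spanJ) x∈spanS =
    (λ j∈J → p⊆p∪q ⁅ x ⁆ (J⊆S j∈J)) , indJ , S∪x⊆spanJ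
    where
    S∪x⊆spanJ : ∀ {t} → t ∈ S ∪ ⁅ x ⁆ → Span A J (col A t)
    S∪x⊆spanJ t∈ with x∈p∪q⁻ S ⁅ x ⁆ t∈
    ... | inj₁ t∈S = S⊆spanJ t∈S
    ... | inj₂ t∈⁅x⁆ rewrite x∈⁅y⁆⇒x≡y x t∈⁅x⁆ = span-trans S⊆spanJ x∈spanS

  basis-empty : ∀ {S} → ¬ Nonempty S → Basis A S ∅
  basis-empty empty =
    (λ x∈∅ → ⊥-elim (∉⊥ x∈∅)) , (λ (T , T⊆∅ , (x , x∈T) , _) → ∉⊥ (T⊆∅ x∈T)) ,
    λ {s} s∈S → ⊥-elim (empty (s , s∈S))

  basis-spanned : ∀ {S J s} → s ∈ S → Basis A (S - s) J → Span A J (col A s) → Basis A S J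
  basis-spanned {S} {J} {s} s∈S (J⊆S-s , indJ , S-s⊆spanJ) s∈spanJ =
    (λ j∈J → p─q⊆p S ⁅ s ⁆ (J⊆S-s j∈J)) , indJ , S⊆spanJ
    where
    S⊆spanJ : ∀ {t} → t ∈ S → Span A J (col A t)
    S⊆spanJ {t} t∈S with t ≟ s
    ... | yes refl = s∈spanJ
    ... | no t≢s = S-s⊆spanJ (x∈p∧x≢y⇒x∈p-y t∈S t≢s)

  basis-unspanned : ∀ {S J s} → s ∈ S → Basis A (S - s) J → ¬ Span A J (col A s) →
    Basis A S (J ∪ ⁅ s ⁆)
  basis-unspanned {S} {J} {s} s∈S (J⊆S-s , indJ , S-s⊆spanJ) s∉spanJ =
    J∪s⊆S , independent-∪⁅⁆ indJ s∉spanJ , S⊆spanJ∪s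
    where
    J∪s⊆S : J ∪ ⁅ s ⁆ ⊆ S
    J∪s⊆S z∈ with x∈p∪q⁻ J ⁅ s ⁆ z∈
    ... | inj₁ z∈J = p─q⊆p S ⁅ s ⁆ (J⊆S-s z∈J)
    ... | inj₂ z∈⁅s⁆ = subst (_∈ S) (sym (x∈⁅y⁆⇒x≡y s z∈⁅s⁆)) s∈S
    S⊆spanJ∪s : ∀ {t} → t ∈ S → Span A (J ∪ ⁅ s ⁆) (col A t)
    S⊆spanJ∪s {t} t∈S with t ≟ s
    ... | yes refl = span-col (x∈p∪q⁺ (inj₂ (x∈⁅x⁆ t)))
    ... | no t≢s = span-mono (p⊆p∪q ⁅ s ⁆) (S-s⊆spanJ (x∈p∧x≢y⇒x∈p-y t∈S t≢s))

  basis-acc : ∀ S → Acc _<_ ∣ S ∣ → Σ (Subset n) (Basis A S)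
  basis-acc S (acc rec) with nonempty? S
  ... | no empty = ∅ , basis-empty empty
  ... | yes (s , s∈S) with basis-acc (S - s) (rec (x∈p⇒∣p-x∣<∣p∣ s∈S))
  ...   | J , basisJ with span? A J (col A s)
  ...     | yes s∈spanJ = J , basis-spanned s∈S basisJ s∈spanJ
  ...     | no s∉spanJ = J ∪ ⁅ s ⁆ , basis-unspanned s∈S basisJ s∉spanJ

  basis : ∀ S → Σ (Subset n) (Basis A S)
  basis S = basis-acc S (<-wellFounded _)

  span⇒InCl : ∀ {S x} → Span A S (col A x) → InCl A S x
  span⇒InCl {S} x∈spanS with basis S
  ... | J , basisJ = ∣ J ∣ , Basis⇒IsRank basisJ , Basis⇒IsRank (basis-∪⁅⁆ basisJ x∈spanS)

  -- If x were not spanned, a maximum independent subset of S would stay independent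
  -- after adding x, exceeding the common rank.
  InCl⇒span : ∀ {S x} → InCl A S x → Span A S (col A x)
  InCl⇒span {S} {x} (k , ((I , I⊆S , indI , refl) , _) , (_ , maximal)) with span? A S (col A x)
  ... | yes x∈spanS = x∈spanS
  ... | no x∉spanS =
    ⊥-elim (<-irrefl refl (≤-trans ∣I∣<∣I∪x∣ (maximal (I ∪ ⁅ x ⁆) I∪x⊆S∪x I∪x-indep)))
    where
    I∪x-indep : Independent A (I ∪ ⁅ x ⁆)
    I∪x-indep = independent-∪⁅⁆ indI (λ x∈spanI → x∉spanS (span-mono I⊆S x∈spanI))
    x∉I : x ∉ I
    x∉I x∈I = x∉spanS (span-col (I⊆S x∈I))
    ∣I∣<∣I∪x∣ : ∣ I ∣ < ∣ I ∪ ⁅ x ⁆ ∣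
    ∣I∣<∣I∪x∣ = p⊂q⇒∣p∣<∣q∣ (p⊆p∪q ⁅ x ⁆ , x , x∈p∪q⁺ (inj₂ (x∈⁅x⁆ x)) , x∉I)
    I∪x⊆S∪x : I ∪ ⁅ x ⁆ ⊆ S ∪ ⁅ x ⁆
    I∪x⊆S∪x z∈ with x∈p∪q⁻ I ⁅ x ⁆ z∈
    ... | inj₁ z∈I = x∈p∪q⁺ (inj₁ (I⊆S z∈I))
    ... | inj₂ z∈⁅x⁆ = x∈p∪q⁺ (inj₂ z∈⁅x⁆)

  InCl⇔span : ∀ {S x} → InCl A S x ⇔ Span A S (col A x)
  InCl⇔span = mk⇔ InCl⇒span span⇒InCl

circuit-sum : ∀ {A : Mat m n} {C} → Circuit A C → colSum A C ≗ (λ _ → false)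
circuit-sum {A = A} {C} ((S , S⊆C , nonempty , sum) , minimal) with nonempty? (C ─ S)
... | yes (x , x∈C─S) =
  ⊥-elim (minimal S (S⊆C , x , p─q⊆p C S x∈C─S , x∈p─q⇒x∉q C S x∈C─S)
                    (S , (λ z∈ → z∈) , nonempty , sum))
... | no empty =
  subst (λ T → colSum A T ≗ (λ _ → false)) (⊆-antisym S⊆C (Empty[p─q]⇒p⊆q C S empty)) sum

isOdd : ℕ → Bool
isOdd zero = false
isOdd (suc k) = not (isOdd k)

isOdd-% : ∀ k → k % 2 ≡ 1 → isOdd k ≡ true
isOdd-% (suc zero) _ = refl
isOdd-% (suc (suc k)) k%2≡1 = trans (not-involutive (isOdd k)) (isOdd-% k k%2≡1)

sumF-lookup : (S : Subset n) → sumF (lookup S) ≡ isOdd ∣ S ∣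
sumF-lookup [] = refl
sumF-lookup (true ∷ S) = cong not (sumF-lookup S)
sumF-lookup (false ∷ S) = sumF-lookup S

data RowView {m} : Fin (m + 1) → Set where
  oldRow : ∀ i → RowView (i ↑ˡ 1)
  newRow : RowView (m ↑ʳ zero)

rowView : ∀ r → RowView {m} r
rowView {m} r with splitAt m r in eq
... | inj₁ i = subst RowView (splitAt⁻¹-↑ˡ eq) (oldRow i)
... | inj₂ zero = subst RowView (splitAt⁻¹-↑ʳ eq) newRow

data ColumnView {n} : Fin (n + 2) → Set where
  ofE : ∀ y → ColumnView (embE y)
  ofA : ColumnView aCol
  ofγ : ColumnView γCol

columnView : ∀ c → ColumnView {n} c
columnView {n} c with splitAt n c in eq
... | inj₁ y = subst ColumnView (splitAt⁻¹-↑ˡ eq) (ofE y)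
... | inj₂ zero = subst ColumnView (splitAt⁻¹-↑ʳ eq) ofA
... | inj₂ (suc zero) = subst ColumnView (splitAt⁻¹-↑ʳ eq) ofγ

≗-byRows : {u v : Fin (m + 1) → Bool} → (∀ i → u (i ↑ˡ 1) ≡ v (i ↑ˡ 1)) →
  u (m ↑ʳ zero) ≡ v (m ↑ʳ zero) → u ≗ v
≗-byRows old new r with rowView r
... | oldRow i = old i
... | newRow = new

colA-old : ∀ i → colA {m} (i ↑ˡ 1) ≡ false
colA-old {m} i rewrite splitAt-↑ˡ m i 1 = refl

colA-new : colA {m} (m ↑ʳ zero) ≡ true
colA-new {m} rewrite splitAt-↑ʳ m 1 zero = refl

module _ (A : Mat m n) (X : Subset n) where

  withRow-old : ∀ i j → withRow A X (i ↑ˡ 1) j ≡ A i j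
  withRow-old i j rewrite splitAt-↑ˡ m i 1 = refl

  withRow-new : ∀ j → withRow A X (m ↑ʳ zero) j ≡ lookup X j
  withRow-new j rewrite splitAt-↑ʳ m 1 zero = refl

  colSum-withRow-old : ∀ T i → colSum (withRow A X) T (i ↑ˡ 1) ≡ colSum A T i
  colSum-withRow-old T i = sumF-cong _ _ (λ j → cong (lookup T j ∧_) (withRow-old i j))

  colSum-withRow-new : ∀ T → colSum (withRow A X) T (m ↑ʳ zero) ≡ sumF (lookup (T ∩ X))
  colSum-withRow-new T =
    sumF-cong _ _ (λ j → trans (cong (lookup T j ∧_) (withRow-new j))
                               (sym (lookup-zipWith _∧_ j T X)))

  module _ (e : Fin n) where

    esMatrix-embE : ∀ r j → esMatrix A X e r (embE j) ≡ withRow A X r j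
    esMatrix-embE r j rewrite splitAt-↑ˡ n j 2 = refl

    esMatrix-aCol : ∀ r → esMatrix A X e r aCol ≡ colA r
    esMatrix-aCol r rewrite splitAt-↑ʳ n 2 zero = refl

    esMatrix-old-embE : ∀ i j → esMatrix A X e (i ↑ˡ 1) (embE j) ≡ A i j
    esMatrix-old-embE i j = trans (esMatrix-embE (i ↑ˡ 1) j) (withRow-old i j)

    esMatrix-old-aCol : ∀ i → esMatrix A X e (i ↑ˡ 1) aCol ≡ false
    esMatrix-old-aCol i = trans (esMatrix-aCol (i ↑ˡ 1)) (colA-old i)

    esMatrix-old-γCol : ∀ i → esMatrix A X e (i ↑ˡ 1) γCol ≡ A i e
    esMatrix-old-γCol i rewrite splitAt-↑ʳ n 2 (suc zero) | splitAt-↑ˡ m i 1 = refl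

span-colA⇒last-row-free : ∀ {B : Mat (m + 1) n} {K u v} → Span B K colA → Span B K u →
  (∀ i → u (i ↑ˡ 1) ≡ v (i ↑ˡ 1)) → Span B K v
span-colA⇒last-row-free {m = m} {u = u} {v} colA∈span u∈span old
  with u (m ↑ʳ zero) Bool.≟ v (m ↑ʳ zero)
... | yes new = span-cong (≗-byRows old new) u∈span
... | no new≢ = span-cong (≗-byRows old′ new′) (span-xor u∈span colA∈span)
  where
  old′ : ∀ i → u (i ↑ˡ 1) xor colA (i ↑ˡ 1) ≡ v (i ↑ˡ 1)
  old′ i rewrite colA-old {m} i = trans (xor-identityʳ _) (old i)
  new′ : u (m ↑ʳ zero) xor colA (m ↑ʳ zero) ≡ v (m ↑ʳ zero)
  new′ rewrite colA-new {m} =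
    trans (xor-comm _ true) (trans (true-xor _) (sym (¬-not (new≢ ∘ sym))))

-- Spans in the es-splitting matrix

module _ (AM : Mat m n) (X : Subset n) (e : Fin n) (A′ : Subset (n + 2)) where

  private
    M′ = esMatrix AM X e
    A = restrictE A′

  ∈-restrictE⁻ : ∀ {y} → y ∈ A → embE y ∈ A′
  ∈-restrictE⁻ {y} y∈A = lookup⇒[]= (embE y) A′ (trans (sym (lookup∘tabulate _ y)) ([]=⇒lookup y∈A))

  ∈-restrictE⁺ : ∀ {y} → embE y ∈ A′ → y ∈ A
  ∈-restrictE⁺ {y} y∈A′ = lookup⇒[]= y A (trans (lookup∘tabulate _ y) ([]=⇒lookup y∈A′))

  span-withRow⇒span-es : ∀ {u} → Span (withRow AM X) A u → Span M′ A′ u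
  span-withRow⇒span-es =
    span-trans λ {y} y∈A →
      span-cong (λ r → esMatrix-embE AM X e r y) (span-col (∈-restrictE⁻ y∈A))

  colA-spanned : (aCol ∉ A′ × γCol ∉ A′ × ContainsOXCircuit AM X A) ⊎ (aCol ∈ A′ × γCol ∉ A′) →
    Span M′ A′ colA
  colA-spanned (inj₂ (a∈A′ , _)) = span-cong (esMatrix-aCol AM X e) (span-col a∈A′)
  colA-spanned (inj₁ (_ , _ , C , (circuit , odd) , C⊆A)) =
    span-cong (≗-byRows old new) (span-withRow⇒span-es (C , C⊆A , λ _ → refl))
    where
    old : ∀ i → colSum (withRow AM X) C (i ↑ˡ 1) ≡ colA (i ↑ˡ 1)
    old i = trans (colSum-withRow-old AM X C i) (trans (circuit-sum circuit i) (sym (colA-old i)))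
    new : colSum (withRow AM X) C (m ↑ʳ zero) ≡ colA (m ↑ʳ zero)
    new = trans (colSum-withRow-new AM X C)
            (trans (sumF-lookup (C ∩ X)) (trans (isOdd-% ∣ C ∩ X ∣ odd) (sym colA-new)))

  module _ (colA∈span : Span M′ A′ colA) (γ∉A′ : γCol ∉ A′) where

    old-column-spanned : ∀ {c} → ColumnView c → c ∈ A′ → Span AM A (λ i → M′ (i ↑ˡ 1) c)
    old-column-spanned (ofE y) y∈A′ =
      span-cong (λ i → sym (esMatrix-old-embE AM X e i y)) (span-col (∈-restrictE⁺ y∈A′))
    old-column-spanned ofA _ = span-cong (λ i → sym (esMatrix-old-aCol AM X e i)) span-zero
    old-column-spanned ofγ γ∈A′ = ⊥-elim (γ∉A′ γ∈A′)

    span-es⇔span-old-rows : ∀ {v} → Span M′ A′ v ⇔ Span AM A (λ i → v (i ↑ˡ 1))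
    span-es⇔span-old-rows = mk⇔
      (λ v∈span → span-trans (λ {c} → old-column-spanned (columnView c)) (span-rows (_↑ˡ 1) v∈span))
      (λ { (T , T⊆A , sum) →
        span-colA⇒last-row-free colA∈span (span-withRow⇒span-es (T , T⊆A , λ _ → refl))
          (λ i → trans (colSum-withRow-old AM X T i) (sum i)) })

    InCl-es⇔span-old-rows : ∀ {x} → InCl M′ A′ x ⇔ Span AM A (λ i → M′ (i ↑ˡ 1) x)
    InCl-es⇔span-old-rows = span-es⇔span-old-rows ⇔-∘ InCl⇔span

    module _ (e∉clA : ¬ InCl AM A e) where

      InClA∪a : Fin (n + 2) → Set
      InClA∪a x = (Σ (Fin n) λ y → x ≡ embE y × InCl AM A y) ⊎ x ≡ aCol

      InCl-es⇒InClA∪a : ∀ {x} → ColumnView x → InCl M′ A′ x → InClA∪a x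
      InCl-es⇒InClA∪a (ofE y) y∈cl′ =
        inj₁ (y , refl , span⇒InCl (span-cong (λ i → esMatrix-old-embE AM X e i y)
                                              (Equivalence.to InCl-es⇔span-old-rows y∈cl′)))
      InCl-es⇒InClA∪a ofA _ = inj₂ refl
      InCl-es⇒InClA∪a ofγ γ∈cl′ =
        ⊥-elim (e∉clA (span⇒InCl (span-cong (esMatrix-old-γCol AM X e)
                                           (Equivalence.to InCl-es⇔span-old-rows γ∈cl′))))

      InClA∪a⇒InCl-es : ∀ {x} → InClA∪a x → InCl M′ A′ x
      InClA∪a⇒InCl-es (inj₁ (y , refl , y∈clA)) =
        Equivalence.from InCl-es⇔span-old-rows
          (span-cong (λ i → sym (esMatrix-old-embE AM X e i y)) (InCl⇒span y∈clA))
      InClA∪a⇒InCl-es (inj₂ refl) =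
        Equivalence.from InCl-es⇔span-old-rows
          (span-cong (λ i → sym (esMatrix-old-aCol AM X e i)) span-zero)

lemma3p5 : ∀ {m n} (AM : Mat m n) (X : Subset n) (e : Fin n) → e ∈ X →
    (A′ : Subset (n + 2)) →
    ¬ InCl AM (restrictE A′) e →
    ((aCol ∉ A′ × γCol ∉ A′ × ContainsOXCircuit AM X (restrictE A′))
      ⊎ (aCol ∈ A′ × γCol ∉ A′)) →
    ∀ (x : Fin (n + 2)) →
      InCl (esMatrix AM X e) A′ x
        ⇔ ((Σ (Fin n) λ y → x ≡ embE y × InCl AM (restrictE A′) y) ⊎ x ≡ aCol)
lemma3p5 AM X e _ A′ e∉clA cases x =
  mk⇔ (InCl-es⇒InClA∪a AM X e A′ colA∈span γ∉A′ e∉clA (columnView x))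
      (InClA∪a⇒InCl-es AM X e A′ colA∈span γ∉A′ e∉clA)
  where
  colA∈span : Span (esMatrix AM X e) A′ colA
  colA∈span = colA-spanned AM X e A′ cases
  γ∉A′ : γCol ∉ A′
  γ∉A′ = [ proj₁ ∘ proj₂ , proj₂ ]′ cases
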